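{- Let $A=\{a,b\}$, let $m=\mathit{MinPal}(A^{\mathbb N}_{\mathrm{cl}})$ (which is finite), and let $\omega\in A^{\mathbb N}$ be closed under reversal with $\#\mathrm{PAL}(\omega)=m$. Let $k$ be a positive integer. If $a^k$ is a factor of $\omega$ then $ba^kb$ is a factor of $\omega$; likewise if $b^k$ is a factor of $\omega$ then $ab^ka$ is a factor of $\omega$.
   Context: $A^{\mathbb N}_{\mathrm{cl}}$ is the set of infinite words over $A$ closed under reversal (the reversal of every factor is a factor). $\mathrm{PAL}(\omega)$ is the set of palindromic factors of $\omega$ including the empty word, and $\mathit{MinPal}(X)=\inf\{\#\mathrm{PAL}(\omega)\mid\omega\in X\}$. -}

module Defs where

open import Data.Nat using (ℕ; zero; suc; _≤_; _<_)
open import Data.List using (List; []; _∷_; length; reverse; replicate; _++_)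
open import Data.List.Relation.Unary.Unique.Propositional using (Unique)
open import Data.List.Membership.Propositional using (_∈_)
open import Data.Product using (Σ; ∃; _×_)
open import Relation.Binary.PropositionalEquality using (_≡_)

data A : Set where
  a b : A

Word : Set
Word = ℕ → A

slice : Word → ℕ → ℕ → List A
slice ω i zero    = []
slice ω i (suc n) = ω i ∷ slice ω (suc i) n

Factor : List A → Word → Set
Factor w ω = ∃ λ i → slice ω i (length w) ≡ w

IsPal : List A → Set
IsPal w = reverse w ≡ w

ClosedUnderReversal : Word → Set
ClosedUnderReversal ω = ∀ w → Factor w ω → Factor (reverse w) ω

-- #PAL(ω) = n : the set PAL(ω) of palindromic factors (including the empty
-- word) is finite with exactly n elements.
PalCount : Word → ℕ → Set
PalCount ω n = Σ (List (List A)) λ ps →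
  length ps ≡ n × Unique ps ×
  (∀ w → (w ∈ ps → IsPal w × Factor w ω) × (IsPal w × Factor w ω → w ∈ ps))

-- MinPal(A^ℕ_cl) = m (a finite value): m is attained by some closed word,
-- and every closed word whose PAL set is finite has at least m palindromic
-- factors (words with infinitely many are automatically ≥ m).
IsMinPalCl : ℕ → Set
IsMinPalCl m =
  (∃ λ ω → ClosedUnderReversal ω × PalCount ω m) ×
  (∀ ω n → ClosedUnderReversal ω → PalCount ω n → m ≤ n)

-- If y x^k y were not a factor of ω, shortening the long x-runs of ω would give a closed word with
-- fewer palindromes. Since PAL(ω) is finite, some power of x is not a factor, so
-- ω = x^r₀ y x^r₁ y x^r₂ ⋯, and no inner run rᵢ₊₁ equals k. Let ω′ arise from ω by shortening every
-- run of length ≥ k by one, and let stretch lengthen every x-run of length ≥ k of a finite word by one.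
-- Because no inner run equals k, w is a factor of ω′ iff stretch w is a factor of ω; moreover stretch
-- is injective and commutes with reversal. So ω′ is closed under reversal and stretch maps PAL(ω′)
-- injectively into PAL(ω) minus x^k, hence #PAL(ω′) < #PAL(ω), contradicting minimality. As y x^k y
-- is a palindrome, whether it is a factor is decided by the finite list PAL(ω).

module Submission where

open import Defs
open import Function using (_∘_; _⇔_; mk⇔; Equivalence)
open import Data.Product.Function.NonDependent.Propositional using (_×-⇔_)
open import Data.Nat using (ℕ; zero; suc; pred; _+_; _∸_; _≤_; _<_; _≮_; z≤n; s≤s; _<?_; NonZero; >-nonZero; >-nonZero⁻¹)
open import Data.Nat.Properties hiding (_≟_)
open import Data.List as List using (List; []; _∷_; replicate; _++_; length; reverse; filter; deduplicate; _∷ʳ_)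
open import Data.List.Properties
open import Data.List.Extrema.Nat using (max; xs≤max)
open import Data.List.Relation.Unary.All as All using (All)
open import Data.List.Relation.Unary.AllPairs using ([]; _∷_)
open import Data.List.Relation.Unary.Any using (here; there)
open import Data.List.Relation.Unary.Unique.Propositional using (Unique)
open import Data.List.Relation.Unary.Unique.Propositional.Properties using (map⁺)
open import Data.List.Membership.Propositional using (_∈_)
open import Data.List.Membership.Propositional.Properties
  using (∈-∃++; ∈-++⁻; ∈-++⁺ˡ; ∈-++⁺ʳ; ∈-map⁺; ∈-map⁻; ∈-filter⁺; ∈-filter⁻; ∈-deduplicate⁺; ∈-deduplicate⁻)
open import Data.Product using (∃; ∃₂; _×_; _,_; proj₁; proj₂)
open import Data.Sum using (_⊎_; inj₁; inj₂)
open import Data.Unit using (⊤; tt)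
open import Relation.Nullary using (¬_; Dec; yes; no; contradiction)
open import Relation.Binary.Definitions using (DecidableEquality)
open import Relation.Binary.PropositionalEquality hiding ([_])

_≟_ : DecidableEquality A
a ≟ a = yes refl
a ≟ b = no λ ()
b ≟ a = no λ ()
b ≟ b = yes refl

open import Data.List.Membership.DecPropositional (≡-dec _≟_) using (_∈?_)
open import Data.List.Relation.Unary.Unique.DecPropositional.Properties (≡-dec _≟_) using (deduplicate-!)

other : A → A
other a = b
other b = a

≢other : ∀ x → x ≢ other x
≢other a ()
≢other b ()

≢⇒≡other : ∀ {x c} → c ≢ x → c ≡ other x
≢⇒≡other {a} {a} c≢x = contradiction refl c≢x
≢⇒≡other {a} {b} _   = refl
≢⇒≡other {b} {a} _   = refl
≢⇒≡other {b} {b} c≢x = contradiction refl c≢x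

_↓_ : Word → ℕ → Word
(ω ↓ n) m = ω (n + m)

infix 4 _≼_

_≼_ : List A → Word → Set
[]      ≼ ω = ⊤
(c ∷ w) ≼ ω = ω 0 ≡ c × w ≼ ω ∘ suc

slice-suc : ∀ ω i n → slice ω (suc i) n ≡ slice (ω ∘ suc) i n
slice-suc ω i zero    = refl
slice-suc ω i (suc n) = cong (ω (suc i) ∷_) (slice-suc ω (suc i) n)

slice-↓ : ∀ ω i n → slice ω i n ≡ slice (ω ↓ i) 0 n
slice-↓ ω zero    n = refl
slice-↓ ω (suc i) n = trans (slice-suc ω i n) (slice-↓ (ω ∘ suc) i n)

slice≡⇒≼ : ∀ ω w → slice ω 0 (length w) ≡ w → w ≼ ω
slice≡⇒≼ ω []      _  = tt
slice≡⇒≼ ω (c ∷ w) eq =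
  let hd , tl = ∷-injective eq in
  hd , slice≡⇒≼ (ω ∘ suc) w (trans (sym (slice-suc ω 0 (length w))) tl)

≼⇒slice≡ : ∀ ω w → w ≼ ω → slice ω 0 (length w) ≡ w
≼⇒slice≡ ω []      _        = refl
≼⇒slice≡ ω (c ∷ w) (hd , tl) =
  cong₂ _∷_ hd (trans (slice-suc ω 0 (length w)) (≼⇒slice≡ (ω ∘ suc) w tl))

Factor⇒≼↓ : ∀ {w ω} → Factor w ω → ∃ λ n → w ≼ ω ↓ n
Factor⇒≼↓ {w} {ω} (n , eq) = n , slice≡⇒≼ (ω ↓ n) w (trans (sym (slice-↓ ω n (length w))) eq)

≼↓⇒Factor : ∀ {w ω} n → w ≼ ω ↓ n → Factor w ω
≼↓⇒Factor {w} {ω} n w≼ = n , trans (slice-↓ ω n (length w)) (≼⇒slice≡ (ω ↓ n) w w≼)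

≼-resp-≗ : ∀ {w ω ω′} → ω ≗ ω′ → w ≼ ω → w ≼ ω′
≼-resp-≗ {[]}    ω≗ω′ _         = tt
≼-resp-≗ {c ∷ w} ω≗ω′ (hd , tl) = trans (sym (ω≗ω′ 0)) hd , ≼-resp-≗ (ω≗ω′ ∘ suc) tl

Factor-resp-≗ : ∀ {w ω ω′} → ω ≗ ω′ → Factor w ω → Factor w ω′
Factor-resp-≗ ω≗ω′ w∈ω =
  let n , w≼ = Factor⇒≼↓ w∈ω in ≼↓⇒Factor n (≼-resp-≗ (λ m → ω≗ω′ (n + m)) w≼)

↓-suc : ∀ ω {ω′ : Word} n → ω ↓ n ≗ ω′ → ω ↓ suc n ≗ ω′ ∘ suc
↓-suc ω n ω↓n≗ω′ m = trans (cong ω (sym (+-suc n m))) (ω↓n≗ω′ (suc m))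

replicate-∷ʳ : ∀ {X : Set} n (c : X) → replicate n c ∷ʳ c ≡ c ∷ replicate n c
replicate-∷ʳ zero    c = refl
replicate-∷ʳ (suc n) c = cong (c ∷_) (replicate-∷ʳ n c)

reverse-replicate : ∀ {X : Set} n (c : X) → reverse (replicate n c) ≡ replicate n c
reverse-replicate zero    c = refl
reverse-replicate (suc n) c = begin
  reverse (c ∷ replicate n c)   ≡⟨ unfold-reverse c (replicate n c) ⟩
  reverse (replicate n c) ∷ʳ c  ≡⟨ cong (_∷ʳ c) (reverse-replicate n c) ⟩
  replicate n c ∷ʳ c            ≡⟨ replicate-∷ʳ n c ⟩
  c ∷ replicate n c             ∎
  where open ≡-Reasoning

Unique⇒length≤ : ∀ {X : Set} {xs ys : List X} →
                 Unique xs → (∀ {z} → z ∈ xs → z ∈ ys) → length xs ≤ length ys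
Unique⇒length≤ {xs = []}     _               _     = z≤n
Unique⇒length≤ {xs = z ∷ xs} (z∉xs ∷ xs-uniq) xs⊆ys with ∈-∃++ (xs⊆ys (here refl))
... | us , vs , refl = begin
  suc (length xs)             ≤⟨ s≤s (Unique⇒length≤ xs-uniq xs⊆us++vs) ⟩
  suc (length (us ++ vs))     ≡⟨ cong suc (length-++ us) ⟩
  suc (length us + length vs) ≡⟨ +-suc (length us) (length vs) ⟨
  length us + length (z ∷ vs) ≡⟨ length-++ us ⟨
  length (us ++ z ∷ vs)       ∎
  where
  open ≤-Reasoning
  xs⊆us++vs : ∀ {w} → w ∈ xs → w ∈ us ++ vs
  xs⊆us++vs w∈xs with ∈-++⁻ us (xs⊆ys (there w∈xs))
  ... | inj₁ w∈us         = ∈-++⁺ˡ w∈us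
  ... | inj₂ (here w≡z)   = contradiction (sym w≡z) (All.lookup z∉xs w∈xs)
  ... | inj₂ (there w∈vs) = ∈-++⁺ʳ us w∈vs

PalCount⇒Dec-Factor : ∀ {ω n} → PalCount ω n → ∀ w → IsPal w → Dec (Factor w ω)
PalCount⇒Dec-Factor (ps , _ , _ , ps-spec) w w-pal with w ∈? ps
... | yes w∈ps = yes (proj₂ (proj₁ (ps-spec w) w∈ps))
... | no  w∉ps = no λ w∈ω → w∉ps (proj₂ (ps-spec w) (w-pal , w∈ω))

PalCount⇒bounded-power : ∀ {ω n} → PalCount ω n → ∀ c → ∃ λ F → ¬ Factor (replicate F c) ω
PalCount⇒bounded-power (ps , _ , _ , ps-spec) c = suc L , λ cᶠ∈ω →
  let cᶠ∈ps = proj₂ (ps-spec (replicate (suc L) c)) (reverse-replicate (suc L) c , cᶠ∈ω)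
      |cᶠ|≤L = All.lookup (xs≤max 0 (List.map length ps)) (∈-map⁺ length cᶠ∈ps)
  in 1+n≰n (subst (_≤ L) (length-replicate (suc L)) |cᶠ|≤L)
  where
  L : ℕ
  L = max 0 (List.map length ps)

-- h is only needed to enumerate the candidates for PAL(ω′) from the finite list PAL(ω).
PalCount-<-embedding : ∀ {ω ω′ m} (g h : List A → List A) → (∀ w → h (g w) ≡ w) →
                     (∀ w → (IsPal (g w) × Factor (g w) ω) ⇔ (IsPal w × Factor w ω′)) →
                     PalCount ω m → ∀ p → IsPal p → Factor p ω → (∀ w → g w ≢ p) →
                     ∃ λ n → PalCount ω′ n × n < m
PalCount-<-embedding {ω} {ω′} g h h∘g≗id pal⇔ (ps , |ps|≡m , _ , ps-spec) p p-pal p∈ω p∉img =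
  length ps′ , (ps′ , refl , deduplicate-! _ , ps′-spec) , subst (length ps′ <_) |ps|≡m |ps′|<|ps|
  where
  ps′ : List (List A)
  ps′ = deduplicate (≡-dec _≟_) (filter (λ w → g w ∈? ps) (List.map h ps))

  ∈ps′⇒ : ∀ {w} → w ∈ ps′ → g w ∈ ps
  ∈ps′⇒ w∈ps′ = proj₂ (∈-filter⁻ (λ w → g w ∈? ps) {xs = List.map h ps} (∈-deduplicate⁻ (≡-dec _≟_) _ w∈ps′))

  ⇒∈ps′ : ∀ {w} → g w ∈ ps → w ∈ ps′
  ⇒∈ps′ {w} gw∈ps = ∈-deduplicate⁺ (≡-dec _≟_)
    (∈-filter⁺ (λ w → g w ∈? ps) (subst (_∈ List.map h ps) (h∘g≗id w) (∈-map⁺ h gw∈ps)) gw∈ps)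

  ps′-spec : ∀ w → (w ∈ ps′ → IsPal w × Factor w ω′) × (IsPal w × Factor w ω′ → w ∈ ps′)
  ps′-spec w = Equivalence.to (pal⇔ w) ∘ proj₁ (ps-spec (g w)) ∘ ∈ps′⇒
             , ⇒∈ps′ ∘ proj₂ (ps-spec (g w)) ∘ Equivalence.from (pal⇔ w)

  g-injective : ∀ {v w} → g v ≡ g w → v ≡ w
  g-injective {v} {w} eq = trans (sym (h∘g≗id v)) (trans (cong h eq) (h∘g≗id w))

  p∉g[ps′] : All (p ≢_) (List.map g ps′)
  p∉g[ps′] = All.tabulate λ z∈g[ps′] p≡z →
    let w , _ , z≡gw = ∈-map⁻ g z∈g[ps′] in p∉img w (sym (trans p≡z z≡gw))

  p∷g[ps′]⊆ps : ∀ {z} → z ∈ p ∷ List.map g ps′ → z ∈ ps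
  p∷g[ps′]⊆ps (here refl)      = proj₂ (ps-spec p) (p-pal , p∈ω)
  p∷g[ps′]⊆ps (there z∈g[ps′]) with ∈-map⁻ g z∈g[ps′]
  ... | w , w∈ps′ , refl = ∈ps′⇒ w∈ps′

  |ps′|<|ps| : length ps′ < length ps
  |ps′|<|ps| = subst (λ n → suc n ≤ length ps) (length-map g ps′)
    (Unique⇒length≤ (p∉g[ps′] ∷ map⁺ g-injective (deduplicate-! _)) p∷g[ps′]⊆ps)

-- lengthen and shorten form a Galois connection, which needs k ≠ 0: for k = 0,
-- lengthen (shorten 0) = 1.
module Lengthening (k : ℕ) .{{_ : NonZero k}} where

  lengthen : ℕ → ℕ
  lengthen n with n <? k
  ... | yes _ = n
  ... | no  _ = suc n

  shorten : ℕ → ℕ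
  shorten n with n <? k
  ... | yes _ = n
  ... | no  _ = pred n

  lengthen-< : ∀ {n} → n < k → lengthen n ≡ n
  lengthen-< {n} n<k with n <? k
  ... | yes _   = refl
  ... | no  n≮k = contradiction n<k n≮k

  lengthen-≮ : ∀ {n} → n ≮ k → lengthen n ≡ suc n
  lengthen-≮ {n} n≮k with n <? k
  ... | yes n<k = contradiction n<k n≮k
  ... | no  _   = refl

  shorten-< : ∀ {n} → n < k → shorten n ≡ n
  shorten-< {n} n<k with n <? k
  ... | yes _   = refl
  ... | no  n≮k = contradiction n<k n≮k

  shorten-≮ : ∀ {n} → n ≮ k → shorten n ≡ pred n
  shorten-≮ {n} n≮k with n <? k
  ... | yes n<k = contradiction n<k n≮k
  ... | no  _   = refl

  shorten-lengthen : ∀ n → shorten (lengthen n) ≡ n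
  shorten-lengthen n with n <? k
  ... | yes n<k = shorten-< n<k
  ... | no  n≮k = shorten-≮ (n≮k ∘ <-trans (n<1+n n))

  lengthen-shorten : ∀ {n} → n ≢ k → lengthen (shorten n) ≡ n
  lengthen-shorten {n} n≢k with n <? k
  ... | yes n<k = lengthen-< n<k
  lengthen-shorten {zero}  _   | no n≮k = contradiction (>-nonZero⁻¹ k) n≮k
  lengthen-shorten {suc n} n≢k | no n≮k = lengthen-≮ λ n<k → n≢k (≤-antisym n<k (≮⇒≥ n≮k))

  lengthen-shorten-≤ : ∀ n → lengthen (shorten n) ≤ n
  lengthen-shorten-≤ n with n <? k
  ... | yes n<k = ≤-reflexive (lengthen-< n<k)
  ... | no  n≮k with pred n <? k
  ...   | yes _ = pred[n]≤n
  lengthen-shorten-≤ zero    | no n≮k | no _ = contradiction (>-nonZero⁻¹ k) n≮k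
  lengthen-shorten-≤ (suc n) | no _   | no _ = ≤-refl

  lengthen-mono-≤ : ∀ {m n} → m ≤ n → lengthen m ≤ lengthen n
  lengthen-mono-≤ {m} {n} m≤n with m <? k | n <? k
  ... | yes _   | yes _   = m≤n
  ... | yes _   | no  _   = m≤n⇒m≤1+n m≤n
  ... | no  m≮k | yes n<k = contradiction (≤-<-trans m≤n n<k) m≮k
  ... | no  _   | no  _   = s≤s m≤n

  shorten-mono-≤ : ∀ {m n} → m ≤ n → shorten m ≤ shorten n
  shorten-mono-≤ {m} {n} m≤n with m <? k | n <? k
  ... | yes _   | yes _   = m≤n
  ... | yes m<k | no  n≮k = <⇒≤pred (<-≤-trans m<k (≮⇒≥ n≮k))
  ... | no  m≮k | yes n<k = contradiction (≤-<-trans m≤n n<k) m≮k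
  ... | no  _   | no  _   = pred-mono-≤ m≤n

  lengthen≢k : ∀ n → lengthen n ≢ k
  lengthen≢k n with n <? k
  ... | yes n<k = <⇒≢ n<k
  ... | no  n≮k = λ 1+n≡k → n≮k (≤-reflexive 1+n≡k)

  ≤shorten⇒lengthen≤ : ∀ {m n} → m ≤ shorten n → lengthen m ≤ n
  ≤shorten⇒lengthen≤ {n = n} m≤ = ≤-trans (lengthen-mono-≤ m≤) (lengthen-shorten-≤ n)

  lengthen≤⇒≤shorten : ∀ {m n} → lengthen m ≤ n → m ≤ shorten n
  lengthen≤⇒≤shorten {m} le = subst (_≤ _) (shorten-lengthen m) (shorten-mono-≤ le)

infixr 5 _∷_ _⁺++_

-- j₀ ∷ j₁ ∷ ⋯ ∷ [ jₙ ] codes the word x^j₀ y x^j₁ y ⋯ y x^jₙ (see decode); every word over {x, y}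
-- has exactly one code.
data Runs : Set where
  [_] : ℕ → Runs
  _∷_ : ℕ → Runs → Runs

[-]-injective : ∀ {m n} → [ m ] ≡ [ n ] → m ≡ n
[-]-injective refl = refl

mapRuns : (ℕ → ℕ) → Runs → Runs
mapRuns f [ j ]    = [ f j ]
mapRuns f (j ∷ js) = f j ∷ mapRuns f js

_⁺++_ : Runs → Runs → Runs
[ j ]    ⁺++ ks = j ∷ ks
(j ∷ js) ⁺++ ks = j ∷ (js ⁺++ ks)

reverseRuns : Runs → Runs
reverseRuns [ j ]    = [ j ]
reverseRuns (j ∷ js) = reverseRuns js ⁺++ [ j ]

mapRuns-⁺++ : ∀ f js ks → mapRuns f (js ⁺++ ks) ≡ mapRuns f js ⁺++ mapRuns f ks
mapRuns-⁺++ f [ j ]    ks = refl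
mapRuns-⁺++ f (j ∷ js) ks = cong (f j ∷_) (mapRuns-⁺++ f js ks)

mapRuns-reverse : ∀ f js → mapRuns f (reverseRuns js) ≡ reverseRuns (mapRuns f js)
mapRuns-reverse f [ j ]    = refl
mapRuns-reverse f (j ∷ js) =
  trans (mapRuns-⁺++ f (reverseRuns js) [ j ]) (cong (_⁺++ [ f j ]) (mapRuns-reverse f js))

mapRuns-inverse : ∀ {f g} → (∀ n → g (f n) ≡ n) → ∀ js → mapRuns g (mapRuns f js) ≡ js
mapRuns-inverse g∘f≗id [ j ]    = cong [_] (g∘f≗id j)
mapRuns-inverse g∘f≗id (j ∷ js) = cong₂ _∷_ (g∘f≗id j) (mapRuns-inverse g∘f≗id js)

module RunEncoding (x : A) where

  y : A
  y = other x

  decode : Runs → List A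
  decode [ zero ]     = []
  decode [ suc j ]    = x ∷ decode [ j ]
  decode (zero  ∷ js) = y ∷ decode js
  decode (suc j ∷ js) = x ∷ decode (j ∷ js)

  decode-[] : ∀ j → decode [ j ] ≡ replicate j x
  decode-[] zero    = refl
  decode-[] (suc j) = cong (x ∷_) (decode-[] j)

  decode-⁺++ : ∀ js ks → decode (js ⁺++ ks) ≡ decode js ++ y ∷ decode ks
  decode-⁺++ [ zero ]     ks = refl
  decode-⁺++ [ suc j ]    ks = cong (x ∷_) (decode-⁺++ [ j ] ks)
  decode-⁺++ (zero  ∷ js) ks = cong (y ∷_) (decode-⁺++ js ks)
  decode-⁺++ (suc j ∷ js) ks = cong (x ∷_) (decode-⁺++ (j ∷ js) ks)

  reverse-decode : ∀ js → reverse (decode js) ≡ decode (reverseRuns js)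
  reverse-decode [ j ]    = begin
    reverse (decode [ j ])   ≡⟨ cong reverse (decode-[] j) ⟩
    reverse (replicate j x)  ≡⟨ reverse-replicate j x ⟩
    replicate j x            ≡⟨ decode-[] j ⟨
    decode [ j ]             ∎
    where open ≡-Reasoning
  reverse-decode (j ∷ js) = begin
    reverse (decode ([ j ] ⁺++ js))                    ≡⟨ cong reverse (decode-⁺++ [ j ] js) ⟩
    reverse (decode [ j ] ++ y ∷ decode js)            ≡⟨ reverse-++ (decode [ j ]) (y ∷ decode js) ⟩
    reverse (y ∷ decode js) ++ reverse (decode [ j ])  ≡⟨ cong (_++ _) (unfold-reverse y (decode js)) ⟩
    reverse (decode js) ∷ʳ y ++ reverse (decode [ j ]) ≡⟨ ∷ʳ-++ (reverse (decode js)) y _ ⟩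
    reverse (decode js) ++ y ∷ reverse (decode [ j ])  ≡⟨ cong₂ (λ u v → u ++ y ∷ v) (reverse-decode js) (reverse-decode [ j ]) ⟩
    decode (reverseRuns js) ++ y ∷ decode [ j ]        ≡⟨ decode-⁺++ (reverseRuns js) [ j ] ⟨
    decode (reverseRuns js ⁺++ [ j ])                  ∎
    where open ≡-Reasoning

  suc-head : Runs → Runs
  suc-head [ j ]    = [ suc j ]
  suc-head (j ∷ js) = suc j ∷ js

  encode : List A → Runs
  encode []      = [ 0 ]
  encode (c ∷ w) with c ≟ x
  ... | yes _ = suc-head (encode w)
  ... | no  _ = 0 ∷ encode w

  encode-x∷ : ∀ w → encode (x ∷ w) ≡ suc-head (encode w)
  encode-x∷ w with x ≟ x
  ... | yes _   = refl
  ... | no  x≢x = contradiction refl x≢x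

  encode-y∷ : ∀ w → encode (y ∷ w) ≡ 0 ∷ encode w
  encode-y∷ w with y ≟ x
  ... | yes y≡x = contradiction (sym y≡x) (≢other x)
  ... | no  _   = refl

  decode-suc-head : ∀ js → decode (suc-head js) ≡ x ∷ decode js
  decode-suc-head [ j ]    = refl
  decode-suc-head (j ∷ js) = refl

  decode-encode : ∀ w → decode (encode w) ≡ w
  decode-encode []      = refl
  decode-encode (c ∷ w) with c ≟ x
  ... | yes refl = trans (decode-suc-head (encode w)) (cong (x ∷_) (decode-encode w))
  ... | no  c≢x  = cong₂ _∷_ (sym (≢⇒≡other c≢x)) (decode-encode w)

  encode-decode : ∀ js → encode (decode js) ≡ js
  encode-decode [ zero ]     = refl
  encode-decode [ suc j ]    = trans (encode-x∷ (decode [ j ])) (cong suc-head (encode-decode [ j ]))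
  encode-decode (zero  ∷ js) = trans (encode-y∷ (decode js)) (cong (0 ∷_) (encode-decode js))
  encode-decode (suc j ∷ js) = trans (encode-x∷ (decode (j ∷ js))) (cong suc-head (encode-decode (j ∷ js)))

  decode-injective : ∀ {js ks} → decode js ≡ decode ks → js ≡ ks
  decode-injective {js} {ks} eq = begin
    js                  ≡⟨ encode-decode js ⟨
    encode (decode js)  ≡⟨ cong encode eq ⟩
    encode (decode ks)  ≡⟨ encode-decode ks ⟩
    ks                  ∎
    where open ≡-Reasoning

  encode-reverse : ∀ w → encode (reverse w) ≡ reverseRuns (encode w)
  encode-reverse w = begin
    encode (reverse w)                     ≡⟨ cong (encode ∘ reverse) (decode-encode w) ⟨
    encode (reverse (decode (encode w)))   ≡⟨ cong encode (reverse-decode (encode w)) ⟩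
    encode (decode (reverseRuns (encode w))) ≡⟨ encode-decode _ ⟩
    reverseRuns (encode w)                 ∎
    where open ≡-Reasoning

  decode-yxᵏy : ∀ k → decode (0 ∷ k ∷ [ 0 ]) ≡ y ∷ replicate k x ++ y ∷ []
  decode-yxᵏy k = cong (y ∷_) (trans (decode-⁺++ [ k ] [ 0 ]) (cong (_++ y ∷ []) (decode-[] k)))

  IsPal-yxᵏy : ∀ k → IsPal (y ∷ replicate k x ++ y ∷ [])
  IsPal-yxᵏy k = subst IsPal (decode-yxᵏy k) (reverse-decode (0 ∷ k ∷ [ 0 ]))

  -- runsWord ρ c is the infinite word x^c y x^(ρ 0) y x^(ρ 1) y ⋯
  runsWord : (ℕ → ℕ) → ℕ → Word
  runsWord ρ (suc c) zero    = x
  runsWord ρ (suc c) (suc n) = runsWord ρ c n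
  runsWord ρ zero    zero    = y
  runsWord ρ zero    (suc n) = runsWord (ρ ∘ suc) (ρ 0) n

  runsWord-cong : ∀ {ρ σ} → ρ ≗ σ → ∀ c → runsWord ρ c ≗ runsWord σ c
  runsWord-cong ρ≗σ (suc c) zero    = refl
  runsWord-cong ρ≗σ (suc c) (suc n) = runsWord-cong ρ≗σ c n
  runsWord-cong ρ≗σ zero    zero    = refl
  runsWord-cong {ρ} {σ} ρ≗σ zero (suc n) =
    trans (cong (λ c → runsWord (ρ ∘ suc) c n) (ρ≗σ 0)) (runsWord-cong (ρ≗σ ∘ suc) (σ 0) n)

  RunPrefix : Runs → (ℕ → ℕ) → ℕ → Set
  RunPrefix [ j ]    ρ c = j ≤ c
  RunPrefix (j ∷ js) ρ c = j ≡ c × RunPrefix js (ρ ∘ suc) (ρ 0)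

  decode-≼⇒RunPrefix : ∀ js ρ c → decode js ≼ runsWord ρ c → RunPrefix js ρ c
  decode-≼⇒RunPrefix [ zero ]     ρ c       _         = z≤n
  decode-≼⇒RunPrefix [ suc j ]    ρ zero    (y≡x , _) = contradiction (sym y≡x) (≢other x)
  decode-≼⇒RunPrefix [ suc j ]    ρ (suc c) (_ , p)   = s≤s (decode-≼⇒RunPrefix [ j ] ρ c p)
  decode-≼⇒RunPrefix (zero  ∷ js) ρ zero    (_ , p)   = refl , decode-≼⇒RunPrefix js (ρ ∘ suc) (ρ 0) p
  decode-≼⇒RunPrefix (zero  ∷ js) ρ (suc c) (x≡y , _) = contradiction x≡y (≢other x)
  decode-≼⇒RunPrefix (suc j ∷ js) ρ zero    (y≡x , _) = contradiction (sym y≡x) (≢other x)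
  decode-≼⇒RunPrefix (suc j ∷ js) ρ (suc c) (_ , p)   =
    let j≡c , q = decode-≼⇒RunPrefix (j ∷ js) ρ c p in cong suc j≡c , q

  RunPrefix⇒decode-≼ : ∀ js ρ c → RunPrefix js ρ c → decode js ≼ runsWord ρ c
  RunPrefix⇒decode-≼ [ zero ]     ρ c       _              = tt
  RunPrefix⇒decode-≼ [ suc j ]    ρ (suc c) (s≤s j≤c)      = refl , RunPrefix⇒decode-≼ [ j ] ρ c j≤c
  RunPrefix⇒decode-≼ (zero  ∷ js) ρ zero    (_ , p)        = refl , RunPrefix⇒decode-≼ js (ρ ∘ suc) (ρ 0) p
  RunPrefix⇒decode-≼ (suc j ∷ js) ρ (suc c) (1+j≡1+c , p) =
    refl , RunPrefix⇒decode-≼ (j ∷ js) ρ c (suc-injective 1+j≡1+c , p)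

  fromRuns : (ℕ → ℕ) → Word
  fromRuns r = runsWord (r ∘ suc) (r 0)

  -- The suffix of fromRuns r that starts inside block i, with c letters x of that block left.
  inBlock : (ℕ → ℕ) → ℕ → ℕ → Word
  inBlock r i c = runsWord (λ t → r (suc i + t)) c

  inBlock-next : ∀ r i n → inBlock r i 0 (suc n) ≡ inBlock r (suc i) (r (suc i)) n
  inBlock-next r i n =
    trans (cong (λ c → runsWord (λ t → r (suc i + suc t)) c n) (cong (r ∘ suc) (+-identityʳ i)))
          (runsWord-cong (λ t → cong r (+-suc (suc i) t)) (r (suc i)) n)

  inBlock-↓ : ∀ r n i c → c ≤ r i → ∃₂ λ i′ c′ → c′ ≤ r i′ × inBlock r i c ↓ n ≗ inBlock r i′ c′
  inBlock-↓ r zero    i c       c≤ = i , c , c≤ , λ _ → refl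
  inBlock-↓ r (suc n) i (suc c) c≤ = inBlock-↓ r n i c (≤-trans (n≤1+n c) c≤)
  inBlock-↓ r (suc n) i zero    _  =
    let i′ , c′ , c′≤ , eq = inBlock-↓ r n (suc i) (r (suc i)) ≤-refl
    in i′ , c′ , c′≤ , λ m → trans (inBlock-next r i (n + m)) (eq m)

  fromRuns-↓ : ∀ r i c → c ≤ r i → ∃ λ n → fromRuns r ↓ n ≗ inBlock r i c
  fromRuns-↓ r i c c≤ = reach i (r i ∸ c) c (m∸n+n≡m c≤)
    where
    reach : ∀ i d c → d + c ≡ r i → ∃ λ n → fromRuns r ↓ n ≗ inBlock r i c
    reach zero    zero    c refl = 0 , λ _ → refl
    reach (suc i) zero    c refl =
      let n , eq = reach i (r i) 0 (+-identityʳ (r i))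
      in suc n , λ m → trans (↓-suc (fromRuns r) n eq m) (inBlock-next r i m)
    reach i       (suc d) c d+c≡ =
      let n , eq = reach i d (suc c) (trans (+-suc d c) d+c≡) in suc n , ↓-suc (fromRuns r) n eq

  Occurs : Runs → (ℕ → ℕ) → Set
  Occurs js r = ∃₂ λ i c → c ≤ r i × RunPrefix js (λ t → r (suc i + t)) c

  Factor⇒Occurs : ∀ {js r} → Factor (decode js) (fromRuns r) → Occurs js r
  Factor⇒Occurs {js} {r} js∈r =
    let n , js≼         = Factor⇒≼↓ js∈r
        i , c , c≤ , eq = inBlock-↓ r n 0 (r 0) ≤-refl
    in i , c , c≤ , decode-≼⇒RunPrefix js _ c (≼-resp-≗ eq js≼)

  Occurs⇒Factor : ∀ {js r} → Occurs js r → Factor (decode js) (fromRuns r)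
  Occurs⇒Factor {js} {r} (i , c , c≤ , js⊑) =
    let n , eq = fromRuns-↓ r i c c≤
    in ≼↓⇒Factor n (≼-resp-≗ (sym ∘ eq) (RunPrefix⇒decode-≼ js _ c js⊑))

  xRun : ℕ → Word → ℕ
  xRun zero    ω = 0
  xRun (suc f) ω with ω 0 ≟ x
  ... | yes _ = suc (xRun f (ω ∘ suc))
  ... | no  _ = 0

  xRun-x : ∀ f ω {t} → t < xRun f ω → ω t ≡ x
  xRun-x (suc f) ω {t} t< with ω 0 ≟ x
  xRun-x (suc f) ω {zero}  _         | yes ω0≡x = ω0≡x
  xRun-x (suc f) ω {suc t} (s≤s t<) | yes _    = xRun-x f (ω ∘ suc) t<

  xRun-end : ∀ f ω → ω (xRun f ω) ≡ y ⊎ replicate f x ≼ ω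
  xRun-end zero    ω = inj₂ tt
  xRun-end (suc f) ω with ω 0 ≟ x
  ... | no  ω0≢x = inj₁ (≢⇒≡other ω0≢x)
  ... | yes ω0≡x with xRun-end f (ω ∘ suc)
  ...   | inj₁ ends = inj₁ ends
  ...   | inj₂ xᶠ   = inj₂ (ω0≡x , xᶠ)

  runDecomposition : ∀ {F ω} → ¬ Factor (replicate F x) ω → ∃ λ r → ω ≗ fromRuns r
  runDecomposition {F} {ω} no-xᶠ = r , λ n → ω-inBlock n 0 0 (r 0) refl
    where
    runLength : ℕ → ℕ
    runLength q = xRun F (ω ↓ q)

    runLength-end : ∀ q → ω (q + runLength q) ≡ y
    runLength-end q with xRun-end F (ω ↓ q)
    ... | inj₁ ends = ends
    ... | inj₂ xᶠ   = contradiction (≼↓⇒Factor q xᶠ) no-xᶠ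

    start : ℕ → ℕ
    start zero    = 0
    start (suc i) = suc (start i + runLength (start i))

    r : ℕ → ℕ
    r i = runLength (start i)

    ω-inBlock : ∀ n i t c → t + c ≡ r i → ω (start i + t + n) ≡ inBlock r i c n
    ω-inBlock zero i t zero t+0≡ with trans (sym (+-identityʳ t)) t+0≡
    ... | refl = trans (cong ω (+-identityʳ (start i + r i))) (runLength-end (start i))
    ω-inBlock zero i t (suc c) t+c≡ =
      trans (cong ω (+-identityʳ (start i + t))) (xRun-x F (ω ↓ start i) t<r)
      where
      t<r : t < r i
      t<r = ≤-trans (s≤s (m≤m+n t c)) (≤-reflexive (trans (sym (+-suc t c)) t+c≡))
    ω-inBlock (suc n) i t (suc c) t+c≡ =
      trans (cong ω (trans (+-suc (start i + t) n) (cong (_+ n) (sym (+-suc (start i) t)))))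
            (ω-inBlock n i (suc t) c (trans (sym (+-suc t c)) t+c≡))
    ω-inBlock (suc n) i t zero t+0≡ with trans (sym (+-identityʳ t)) t+0≡
    ... | refl =
      trans (cong ω (trans (+-suc (start i + r i) n) (cong (_+ n) (sym (+-identityʳ (suc (start i + r i)))))))
            (trans (ω-inBlock n (suc i) 0 (r (suc i)) refl) (sym (inBlock-next r i n)))

module Stretching (x : A) (k : ℕ) .{{_ : NonZero k}} where

  open RunEncoding x
  open Lengthening k

  stretch : List A → List A
  stretch w = decode (mapRuns lengthen (encode w))

  shrink : List A → List A
  shrink w = decode (mapRuns shorten (encode w))

  shrink-stretch : ∀ w → shrink (stretch w) ≡ w
  shrink-stretch w = begin
    decode (mapRuns shorten (encode (decode (mapRuns lengthen (encode w)))))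
      ≡⟨ cong (decode ∘ mapRuns shorten) (encode-decode (mapRuns lengthen (encode w))) ⟩
    decode (mapRuns shorten (mapRuns lengthen (encode w)))
      ≡⟨ cong decode (mapRuns-inverse shorten-lengthen (encode w)) ⟩
    decode (encode w)
      ≡⟨ decode-encode w ⟩
    w ∎
    where open ≡-Reasoning

  stretch-injective : ∀ {v w} → stretch v ≡ stretch w → v ≡ w
  stretch-injective {v} {w} eq = begin
    v                   ≡⟨ shrink-stretch v ⟨
    shrink (stretch v)  ≡⟨ cong shrink eq ⟩
    shrink (stretch w)  ≡⟨ shrink-stretch w ⟩
    w                   ∎
    where open ≡-Reasoning

  stretch-reverse : ∀ w → stretch (reverse w) ≡ reverse (stretch w)
  stretch-reverse w = begin
    decode (mapRuns lengthen (encode (reverse w)))       ≡⟨ cong (decode ∘ mapRuns lengthen) (encode-reverse w) ⟩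
    decode (mapRuns lengthen (reverseRuns (encode w)))   ≡⟨ cong decode (mapRuns-reverse lengthen (encode w)) ⟩
    decode (reverseRuns (mapRuns lengthen (encode w)))   ≡⟨ reverse-decode (mapRuns lengthen (encode w)) ⟨
    reverse (decode (mapRuns lengthen (encode w)))       ∎
    where open ≡-Reasoning

  IsPal-stretch : ∀ w → IsPal (stretch w) ⇔ IsPal w
  IsPal-stretch w = mk⇔
    (λ pal → stretch-injective (trans (stretch-reverse w) pal))
    (λ pal → trans (sym (stretch-reverse w)) (cong stretch pal))

  stretch≢xᵏ : ∀ w → stretch w ≢ replicate k x
  stretch≢xᵏ w eq = mapRuns-lengthen≢[k] (encode w) (decode-injective (trans eq (sym (decode-[] k))))
    where
    mapRuns-lengthen≢[k] : ∀ js → mapRuns lengthen js ≢ [ k ]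
    mapRuns-lengthen≢[k] [ j ]    = lengthen≢k j ∘ [-]-injective
    mapRuns-lengthen≢[k] (j ∷ js) ()

  -- Inner runs of an occurrence are matched exactly, so they must avoid k, the one point where
  -- lengthen ∘ shorten is not the identity; the first and last runs are only bounded.
  RunPrefix-lengthen : ∀ js {ρ c} → (∀ t → ρ t ≢ k) →
                       RunPrefix js (shorten ∘ ρ) c → RunPrefix (mapRuns lengthen js) ρ (lengthen c)
  RunPrefix-lengthen [ j ]    _   j≤c        = lengthen-mono-≤ j≤c
  RunPrefix-lengthen (j ∷ js) {ρ} ρ≢k (j≡c , js⊑) =
    cong lengthen j≡c ,
    subst (RunPrefix (mapRuns lengthen js) (ρ ∘ suc)) (lengthen-shorten (ρ≢k 0))
          (RunPrefix-lengthen js (ρ≢k ∘ suc) js⊑)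

  RunPrefix-shorten : ∀ js {ρ c} → RunPrefix (mapRuns lengthen js) ρ c → RunPrefix js (shorten ∘ ρ) (shorten c)
  RunPrefix-shorten [ j ]    lj≤c         = lengthen≤⇒≤shorten lj≤c
  RunPrefix-shorten (j ∷ js) (lj≡c , js⊑) =
    trans (sym (shorten-lengthen j)) (cong shorten lj≡c) , RunPrefix-shorten js js⊑

  module _ (r : ℕ → ℕ) (inner≢k : ∀ t → r (suc t) ≢ k) where

    Occurs-lengthen : ∀ {js} → Occurs js (shorten ∘ r) → Occurs (mapRuns lengthen js) r
    Occurs-lengthen {js} (i , c , c≤ , js⊑) =
      i , lengthen c , ≤shorten⇒lengthen≤ c≤ , RunPrefix-lengthen js (λ t → inner≢k (i + t)) js⊑

    Occurs-shorten : ∀ {js} → Occurs (mapRuns lengthen js) r → Occurs js (shorten ∘ r)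
    Occurs-shorten {js} (i , c , c≤ , js⊑) = i , shorten c , shorten-mono-≤ c≤ , RunPrefix-shorten js js⊑

    Factor-stretch : ∀ w → Factor (stretch w) (fromRuns r) ⇔ Factor w (fromRuns (shorten ∘ r))
    Factor-stretch w = mk⇔
      (subst (λ v → Factor v _) (decode-encode w) ∘ Occurs⇒Factor ∘ Occurs-shorten ∘ Factor⇒Occurs)
      (Occurs⇒Factor ∘ Occurs-lengthen ∘ Factor⇒Occurs ∘ subst (λ v → Factor v _) (sym (decode-encode w)))

  fewerPalindromes : ∀ {ω m} → ClosedUnderReversal ω → PalCount ω m →
                     Factor (replicate k x) ω → ¬ Factor (y ∷ replicate k x ++ y ∷ []) ω →
                     ∃₂ λ ω′ n → ClosedUnderReversal ω′ × PalCount ω′ n × n < m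
  fewerPalindromes {ω} closed pc xᵏ∈ω yxᵏy∉ω =
    let n , pc′ , n<m = PalCount-<-embedding stretch shrink shrink-stretch
                          (λ w → IsPal-stretch w ×-⇔ Factor-stretch-ω w)
                          pc (replicate k x) (reverse-replicate k x) xᵏ∈ω stretch≢xᵏ
    in ω′ , n , closed′ , pc′ , n<m
    where
    decomposition : ∃ λ r → ω ≗ fromRuns r
    decomposition = runDecomposition (proj₂ (PalCount⇒bounded-power pc x))

    r : ℕ → ℕ
    r = proj₁ decomposition

    ω≗r : ω ≗ fromRuns r
    ω≗r = proj₂ decomposition

    inner≢k : ∀ t → r (suc t) ≢ k
    inner≢k t r≡k = yxᵏy∉ω (Factor-resp-≗ (sym ∘ ω≗r) (subst (λ v → Factor v (fromRuns r)) (decode-yxᵏy k) yxᵏy∈r))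
      where
      yxᵏy∈r : Factor (decode (0 ∷ k ∷ [ 0 ])) (fromRuns r)
      yxᵏy∈r = Occurs⇒Factor {r = r} (t , 0 , z≤n , refl , trans (sym r≡k) (cong (r ∘ suc) (sym (+-identityʳ t))) , z≤n)

    ω′ : Word
    ω′ = fromRuns (shorten ∘ r)

    Factor-stretch-ω : ∀ w → Factor (stretch w) ω ⇔ Factor w ω′
    Factor-stretch-ω w = mk⇔
      (Equivalence.to (Factor-stretch r inner≢k w) ∘ Factor-resp-≗ ω≗r)
      (Factor-resp-≗ (sym ∘ ω≗r) ∘ Equivalence.from (Factor-stretch r inner≢k w))

    closed′ : ClosedUnderReversal ω′
    closed′ w w∈ω′ = Equivalence.to (Factor-stretch-ω (reverse w))
      (subst (λ v → Factor v ω) (sym (stretch-reverse w))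
        (closed (stretch w) (Equivalence.from (Factor-stretch-ω w) w∈ω′)))

mainTheorem14 : (m : ℕ) → IsMinPalCl m →
    (ω : Word) → ClosedUnderReversal ω → PalCount ω m →
    (k : ℕ) → 1 ≤ k →
    (Factor (replicate k a) ω → Factor (b ∷ replicate k a ++ b ∷ []) ω) ×
    (Factor (replicate k b) ω → Factor (a ∷ replicate k b ++ a ∷ []) ω)
mainTheorem14 m (_ , minimal) ω closed pc k 1≤k = bordered a , bordered b
  where
  instance
    k≢0 : NonZero k
    k≢0 = >-nonZero 1≤k

  bordered : ∀ x → Factor (replicate k x) ω → Factor (other x ∷ replicate k x ++ other x ∷ []) ω
  bordered x xᵏ∈ω with PalCount⇒Dec-Factor pc _ (RunEncoding.IsPal-yxᵏy x k)
  ... | yes yxᵏy∈ω = yxᵏy∈ω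
  ... | no  yxᵏy∉ω =
    let ω′ , n , closed′ , pc′ , n<m = Stretching.fewerPalindromes x k closed pc xᵏ∈ω yxᵏy∉ω
    in contradiction (minimal ω′ n closed′ pc′) (<⇒≱ n<m)
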